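{- Let $\approx$ be an SCER on $\Sigma^*$ and $T$ a string of length $n$. If $k\le l$ (with $0\le k\le l\le n$), then $\mathsf{Cov}_{\approx}(T[:n-k])\cap\mathsf{LSeed}_{\approx}(T[n-l+1:])\subseteq\mathsf{LSeed}_{\approx}(T)$.
   Context: $\Sigma^*$ is the set of strings over an alphabet $\Sigma$. For a string $T$, $|T|$ is its length, $T[i:j]$ the substring from position $i$ to $j$, $T[:j]=T[1:j]$, $T[i:]=T[i:|T|]$. An SCER is an equivalence relation $\approx$ on $\Sigma^*$ such that $X\approx Y$ implies $|X|=|Y|$ and $X[i:j]\approx Y[i:j]$ for all $1\le i\le j\le|X|$. $\mathsf{Occ}_{P,T}=\{\,i : 1\le i\le |T|-|P|+1,\ P\approx T[i:i+|P|-1]\,\}$. A string $C$ of length $c$ is a $\approx$-cover of $T$ of length $n$ if there are $x_1,\dots,x_m\in\mathsf{Occ}_{C,T}$ with $x_1=1$, $x_m=n-c+1$ and $x_{i-1}<x_i\le x_{i-1}+c$ for all $1<i\le m$; $\mathsf{Cov}_\approx(T)$ is the set of all $\approx$-covers of $T$. A string $S$ of length $m$ is a left $\approx$-seed of a string $T$ of length $n$ if there exist non-negative integers $k,l$ with $k\le l<m$, $S\in\mathsf{Cov}_\approx(T[:n-k])$ and $S[:l]\approx T[n-l+1:]$ (here $S[:0]$ and $T[n+1:]$ are empty). $\mathsf{LSeed}_\approx(T)$ is the set of all left $\approx$-seeds of $T$. -}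

module Defs where

open import Data.Nat using (ℕ; zero; suc; _+_; _∸_; _≤_; _<_)
open import Data.List using (List; length; take; drop)
open import Data.Product using (Σ; _×_; ∃; ∃-syntax; _,_)
open import Relation.Binary.Core using (Rel)
open import Relation.Binary.Structures using (IsEquivalence)
open import Relation.Binary.PropositionalEquality using (_≡_)

-- Strings over an alphabet Σ are lists; positions are 1-indexed as in the paper.

-- T[i:j]  (empty when j = i - 1)
sub : {Σ : Set} → ℕ → ℕ → List Σ → List Σ
sub i j T = take (suc j ∸ i) (drop (i ∸ 1) T)

pre : {Σ : Set} → ℕ → List Σ → List Σ
pre j T = take j T

-- T[i:]  (T[|T|+1:] is empty)
suf : {Σ : Set} → ℕ → List Σ → List Σ
suf i T = drop (i ∸ 1) T

record SCER (Σ : Set) : Set₁ where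
  field
    _≈_     : Rel (List Σ) _
    isEquiv : IsEquivalence _≈_
    len     : ∀ {X Y} → X ≈ Y → length X ≡ length Y
    subst-closed : ∀ {X Y} → X ≈ Y → ∀ i j → 1 ≤ i → i ≤ j → j ≤ length X →
                   sub i j X ≈ sub i j Y

module _ {Σ : Set} (E : SCER Σ) where
  open SCER E

  Occ : List Σ → List Σ → ℕ → Set
  Occ P T i = (1 ≤ i) × (i ≤ length T ∸ length P + 1)
              × (P ≈ sub i (i + length P ∸ 1) T)

  data CovChain (C T : List Σ) : ℕ → Set where
    done : ∀ {x} → Occ C T x → x ≡ length T ∸ length C + 1 → CovChain C T x
    step : ∀ {x y} → Occ C T x → x < y → y ≤ x + length C → CovChain C T y →
           CovChain C T x

  IsCover : List Σ → List Σ → Set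
  IsCover C T = CovChain C T 1

  IsLSeed : List Σ → List Σ → Set
  IsLSeed S T = ∃[ k ] ∃[ l ] (k ≤ l) × (l < length S)
                × IsCover S (pre (length T ∸ k) T)
                × (pre l S ≈ suf (length T ∸ l + 1) T)

-- Let U = T[n-l+1:] and let (k', l') witness that C is a left seed of U.  If k' ≤ k,
-- glue the cover of T[:n-k] to the cover of U[:l-k'] shifted into T: U begins at or
-- before position n-k (as k ≤ l), so the first shifted occurrence starts at most |C|
-- positions after the last occurrence of the other cover, and together they cover
-- T[:n-k'].  If k < k', the cover of T[:n-k] itself works, with k ≤ k' ≤ l'.  The
-- border condition carries over because the last l' letters of U are those of T.
module Submission where

open import Defs
open import Data.Nat using (ℕ; zero; suc; _≤_; _<_; _∸_; _+_; z≤n; s≤s; _≤?_)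
open import Data.Nat.Properties
open import Data.List using (List; []; _∷_; length; take; drop)
open import Data.List.Properties using (length-take; length-drop; take-take; drop-drop)
open import Data.Product using (_×_; _,_)
open import Data.Sum using (inj₁; inj₂; [_,_]′)
open import Relation.Nullary using (yes; no)
open import Relation.Binary.PropositionalEquality

m∸n∸o≡m∸o∸n : ∀ m n o → m ∸ n ∸ o ≡ m ∸ o ∸ n
m∸n∸o≡m∸o∸n m n o = begin
  m ∸ n ∸ o   ≡⟨ ∸-+-assoc m n o ⟩
  m ∸ (n + o) ≡⟨ cong (m ∸_) (+-comm n o) ⟩
  m ∸ (o + n) ≡⟨ sym (∸-+-assoc m o n) ⟩
  m ∸ o ∸ n   ∎
  where open ≡-Reasoning

module _ {A : Set} where

  length-take≤ : ∀ m (xs : List A) → length (take m xs) ≤ length xs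
  length-take≤ m xs = ≤-trans (≤-reflexive (length-take m xs)) (m⊓n≤n m (length xs))

  length-take-≤ : ∀ {m} (xs : List A) → m ≤ length xs → length (take m xs) ≡ m
  length-take-≤ {m} xs m≤ = trans (length-take m xs) (m≤n⇒m⊓n≡m m≤)

  take-drop-take : ∀ a {b m} (xs : List A) → a + b ≤ m →
                   take b (drop a (take m xs)) ≡ take b (drop a xs)
  take-drop-take zero    {b} {m} xs       b≤m      =
    trans (take-take b m xs) (cong (λ i → take i xs) (m≤n⇒m⊓n≡m b≤m))
  take-drop-take (suc a)         []       (s≤s _)  = refl
  take-drop-take (suc a)         (x ∷ xs) (s≤s le) = take-drop-take a xs le

  takeLast : ℕ → List A → List A
  takeLast j xs = drop (length xs ∸ j) xs

  suf≡takeLast : ∀ j (xs : List A) → suf (length xs ∸ j + 1) xs ≡ takeLast j xs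
  suf≡takeLast j xs = cong (λ i → drop i xs) (m+n∸n≡m (length xs ∸ j) 1)

  takeLast-∷ : ∀ {j} x (xs : List A) → j ≤ length xs → takeLast j (x ∷ xs) ≡ takeLast j xs
  takeLast-∷ x xs j≤ = cong (λ i → drop i (x ∷ xs)) (+-∸-assoc 1 j≤)

  takeLast-drop : ∀ d {j} (xs : List A) → j ≤ length (drop d xs) →
                  takeLast j (drop d xs) ≡ takeLast j xs
  takeLast-drop zero    xs       _   = refl
  takeLast-drop (suc d) []       z≤n = refl
  takeLast-drop (suc d) (x ∷ xs) j≤  =
    trans (takeLast-drop d xs j≤)
          (sym (takeLast-∷ x xs (≤-trans j≤ (length-drop≤ d xs))))
    where
    length-drop≤ : ∀ d (xs : List A) → length (drop d xs) ≤ length xs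
    length-drop≤ d xs = ≤-trans (≤-reflexive (length-drop d xs)) (m∸n≤m (length xs) d)

  suf-drop : ∀ d {j} (xs : List A) → j ≤ length (drop d xs) →
             suf (length (drop d xs) ∸ j + 1) (drop d xs) ≡ suf (length xs ∸ j + 1) xs
  suf-drop d {j} xs j≤ = begin
    suf (length (drop d xs) ∸ j + 1) (drop d xs) ≡⟨ suf≡takeLast j (drop d xs) ⟩
    takeLast j (drop d xs)                       ≡⟨ takeLast-drop d xs j≤ ⟩
    takeLast j xs                                ≡⟨ sym (suf≡takeLast j xs) ⟩
    suf (length xs ∸ j + 1) xs                   ∎
    where open ≡-Reasoning

data Chain (P : ℕ → Set) (c e : ℕ) : ℕ → Set where
  done : ∀ {x} → P x → x ≡ e → Chain P c e x
  step : ∀ {x y} → P x → x < y → y ≤ x + c → Chain P c e y → Chain P c e x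

module _ {P : ℕ → Set} {c : ℕ} where

  chain-head : ∀ {e x} → Chain P c e x → P x
  chain-head (done p _)     = p
  chain-head (step p _ _ _) = p

  chain-map : ∀ {Q : ℕ → Set} {e x} → (∀ {y} → P y → Q y) → Chain P c e x → Chain Q c e x
  chain-map f (done p x≡e)      = done (f p) x≡e
  chain-map f (step p x<y y≤ r) = step (f p) x<y y≤ (chain-map f r)

  chain-shift : ∀ {Q : ℕ → Set} {e x} d → (∀ {y} → P y → Q (d + y)) →
                Chain P c e x → Chain Q c (d + e) (d + x)
  chain-shift d f (done p refl) = done (f p) refl
  chain-shift {x = x} d f (step {y = y} p x<y y≤ r) =
    step (f p) (+-monoʳ-< d x<y)
         (subst (d + y ≤_) (sym (+-assoc d x c)) (+-monoʳ-≤ d y≤))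
         (chain-shift d f r)

  chain-cons : ∀ {e x y} → P x → x ≤ y → y ≤ x + c → Chain P c e y → Chain P c e x
  chain-cons p x≤y y≤ r with m≤n⇒m<n∨m≡n x≤y
  ... | inj₁ x<y  = step p x<y y≤ r
  ... | inj₂ refl = r

  -- Follow the first chain while its positions stay at or before y, then jump to y:
  -- the first position past y, or the hypothesis y ≤ e₁ + c at its end, shows that
  -- y is within reach.
  chain-append : ∀ {e₁ e₂ x y} → Chain P c e₁ x → Chain P c e₂ y →
                 x ≤ y → y ≤ e₁ + c → Chain P c e₂ x
  chain-append (done p refl) r x≤y y≤ = chain-cons p x≤y y≤ r
  chain-append {y = y} (step {y = x'} p x<x' x'≤ r₁) r₂ x≤y y≤ with x' ≤? y
  ... | yes x'≤y = step p x<x' x'≤ (chain-append r₁ r₂ x'≤y y≤)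
  ... | no  x'≰y = chain-cons p x≤y (≤-trans (<⇒≤ (≰⇒> x'≰y)) x'≤) r₂

module _ {Σ : Set} (E : SCER Σ) where
  open SCER E

  covChain⇒chain : ∀ {C X x} → CovChain E C X x →
                   Chain (Occ E C X) (length C) (length X ∸ length C + 1) x
  covChain⇒chain (done o x≡e)      = done o x≡e
  covChain⇒chain (step o x<y y≤ r) = step o x<y y≤ (covChain⇒chain r)

  chain⇒covChain : ∀ {C X x} → Chain (Occ E C X) (length C) (length X ∸ length C + 1) x →
                   CovChain E C X x
  chain⇒covChain (done o x≡e)      = done o x≡e
  chain⇒covChain (step o x<y y≤ r) = step o x<y y≤ (chain⇒covChain r)

  Occ-end≤ : ∀ {C X x} → Occ E C X x → x + length C ≤ suc (length X)
  Occ-end≤ {C} {X} {suc x₀} (_ , x≤ , C≈) =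
    s≤s (subst (_≤ length X) (+-comm c x₀) (m≤o∸n⇒m+n≤o c x₀≤ c≤))
    where
    c = length C
    c≤ : c ≤ length X ∸ x₀
    c≤ = begin
      c                                         ≡⟨ len C≈ ⟩
      length (take (x₀ + c ∸ x₀) (drop x₀ X))  ≤⟨ length-take≤ (x₀ + c ∸ x₀) (drop x₀ X) ⟩
      length (drop x₀ X)                        ≡⟨ length-drop x₀ X ⟩
      length X ∸ x₀                             ∎
      where open ≤-Reasoning
    x₀≤ : x₀ ≤ length X
    x₀≤ = ≤-trans (≤-pred (subst (suc x₀ ≤_) (+-comm (length X ∸ c) 1) x≤))
                  (m∸n≤m (length X) c)

  cover-length : ∀ {C X} → IsCover E C X → length C ≤ length X
  cover-length cov = ≤-pred (Occ-end≤ (chain-head (covChain⇒chain cov)))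

  -- An occurrence of C at x in T that ends by position m; unlike Occ in T[:m],
  -- it refers to T itself, so it survives enlarging m and shifting past a prefix.
  OccWithin : List Σ → List Σ → ℕ → ℕ → Set
  OccWithin C T m x = (1 ≤ x) × (x + length C ≤ suc m) × (C ≈ take (length C) (drop (x ∸ 1) T))

  window-take : ∀ {c m} x₀ (T : List Σ) → x₀ + c ≤ m →
                take (x₀ + c ∸ x₀) (drop x₀ (take m T)) ≡ take c (drop x₀ T)
  window-take {c} {m} x₀ T le =
    trans (cong (λ i → take i (drop x₀ (take m T))) (m+n∸m≡n x₀ c)) (take-drop-take x₀ T le)

  Occ-take⇒OccWithin : ∀ {C T m x} → m ≤ length T → Occ E C (take m T) x → OccWithin C T m x
  Occ-take⇒OccWithin {C} {T} {m} {suc x₀} m≤ o@(_ , _ , C≈) =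
    s≤s z≤n , fits , subst (C ≈_) (window-take x₀ T (≤-pred fits)) C≈
    where
    fits : suc x₀ + length C ≤ suc m
    fits = subst (λ n → suc x₀ + length C ≤ suc n) (length-take-≤ T m≤) (Occ-end≤ o)

  OccWithin⇒Occ-take : ∀ {C T m x} → m ≤ length T → OccWithin C T m x → Occ E C (take m T) x
  OccWithin⇒Occ-take {C} {T} {m} {suc x₀} m≤ (_ , s≤s fits , C≈) =
    s≤s z≤n , x≤ , subst (C ≈_) (sym (window-take x₀ T fits)) C≈
    where
    c = length C
    x≤ : suc x₀ ≤ length (take m T) ∸ c + 1
    x≤ = subst (λ n → suc x₀ ≤ n ∸ c + 1) (sym (length-take-≤ T m≤))
           (subst (suc x₀ ≤_) (+-comm 1 (m ∸ c)) (s≤s (m+n≤o⇒m≤o∸n x₀ fits)))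

  OccWithin-mono : ∀ {C T m m'} → m ≤ m' → ∀ {x} → OccWithin C T m x → OccWithin C T m' x
  OccWithin-mono m≤m' (1≤x , fits , C≈) = 1≤x , ≤-trans fits (s≤s m≤m') , C≈

  OccWithin-drop : ∀ {C T p} d → ∀ {y} → OccWithin C (drop d T) p y → OccWithin C T (d + p) (d + y)
  OccWithin-drop {C} {T} {p} d {suc y₀} (_ , fits , C≈) =
    ≤-trans (s≤s z≤n) (m≤n+m (suc y₀) d) ,
    subst₂ _≤_ (sym (+-assoc d (suc y₀) c)) (+-suc d p) (+-monoʳ-≤ d fits) ,
    subst (λ z → C ≈ take c z) shift C≈
    where
    c = length C
    shift : drop y₀ (drop d T) ≡ drop (d + suc y₀ ∸ 1) T
    shift = trans (drop-drop d y₀ T) (cong (λ i → drop (i ∸ 1) T) (sym (+-suc d y₀)))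

  cover-take⇒chain : ∀ {C T m} → m ≤ length T → IsCover E C (take m T) →
                     Chain (OccWithin C T m) (length C) (suc (m ∸ length C)) 1
  cover-take⇒chain {C} {T} {m} m≤ cov =
    subst (λ e → Chain (OccWithin C T m) (length C) e 1) end
          (chain-map (Occ-take⇒OccWithin m≤) (covChain⇒chain cov))
    where
    end : length (take m T) ∸ length C + 1 ≡ suc (m ∸ length C)
    end = trans (cong (λ n → n ∸ length C + 1) (length-take-≤ T m≤)) (+-comm (m ∸ length C) 1)

  chain⇒cover-take : ∀ {C T m} → m ≤ length T →
                     Chain (OccWithin C T m) (length C) (suc (m ∸ length C)) 1 →
                     IsCover E C (take m T)
  chain⇒cover-take {C} {T} {m} m≤ ch =
    chain⇒covChain (chain-map (OccWithin⇒Occ-take m≤)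
                              (subst (λ e → Chain (OccWithin C T m) (length C) e 1) end ch))
    where
    end : suc (m ∸ length C) ≡ length (take m T) ∸ length C + 1
    end = trans (+-comm 1 (m ∸ length C))
                (cong (λ n → n ∸ length C + 1) (sym (length-take-≤ T m≤)))

  cover-glue : ∀ {C T d a b} → d ≤ a → a ≤ b → b ≤ length T →
               IsCover E C (take a T) → IsCover E C (take (b ∸ d) (drop d T)) →
               IsCover E C (take b T)
  cover-glue {C} {T} {d} {a} {b} d≤a a≤b b≤n covA covB =
    chain⇒cover-take b≤n (chain-append chainA chainB (m≤n+m 1 d) reach)
    where
    c = length C
    p = b ∸ d
    chainA : Chain (OccWithin C T b) c (suc (a ∸ c)) 1
    chainA = chain-map (OccWithin-mono a≤b) (cover-take⇒chain (≤-trans a≤b b≤n) covA)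
    chainU : Chain (OccWithin C (drop d T) p) c (suc (p ∸ c)) 1
    chainU = cover-take⇒chain (subst (p ≤_) (sym (length-drop d T)) (∸-monoˡ-≤ d b≤n)) covB
    c≤p : c ≤ p
    c≤p with chain-head chainU
    ... | _ , s≤s fits , _ = fits
    d+p≡b : d + p ≡ b
    d+p≡b = m+[n∸m]≡n (≤-trans d≤a a≤b)
    end : d + suc (p ∸ c) ≡ suc (b ∸ c)
    end = begin
      d + suc (p ∸ c)  ≡⟨ +-suc d (p ∸ c) ⟩
      suc (d + (p ∸ c)) ≡⟨ cong suc (sym (+-∸-assoc d c≤p)) ⟩
      suc (d + p ∸ c)   ≡⟨ cong (λ n → suc (n ∸ c)) d+p≡b ⟩
      suc (b ∸ c)       ∎
      where open ≡-Reasoning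
    chainB : Chain (OccWithin C T b) c (suc (b ∸ c)) (d + 1)
    chainB = subst (λ e → Chain (OccWithin C T b) c e (d + 1)) end
               (chain-map (OccWithin-mono (≤-reflexive d+p≡b))
                          (chain-shift d (OccWithin-drop d) chainU))
    reach : d + 1 ≤ suc (a ∸ c) + c
    reach = begin
      d + 1             ≡⟨ +-comm d 1 ⟩
      suc d             ≤⟨ s≤s d≤a ⟩
      suc a             ≤⟨ s≤s (m≤n+m∸n a c) ⟩
      suc (c + (a ∸ c)) ≡⟨ cong suc (+-comm c (a ∸ c)) ⟩
      suc (a ∸ c) + c   ∎
      where open ≤-Reasoning

lemma10 : {Σ : Set} (E : SCER Σ) (T : List Σ) (k l : ℕ) →
          k ≤ l → l ≤ length T → (C : List Σ) →
          IsCover E C (pre (length T ∸ k) T) →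
          IsLSeed E C (suf (length T ∸ l + 1) T) →
          IsLSeed E C T
lemma10 E T k l k≤l l≤n C covA (k' , l' , k'≤l' , l'<c , covB , border) =
  [ (λ k'≤k → k' , l' , k'≤l' , l'<c ,
               cover-glue E d≤n∸k (∸-monoʳ-≤ n k'≤k) (m∸n≤m n k') covA covB' , border')
  , (λ k≤k' → k , l' , ≤-trans k≤k' k'≤l' , l'<c , covA , border')
  ]′ (≤-total k' k)
  where
  open SCER E
  n = length T
  d = n ∸ l + 1 ∸ 1
  U = drop d T
  d≤n∸k : d ≤ n ∸ k
  d≤n∸k = ≤-trans (≤-reflexive (m+n∸n≡m (n ∸ l) 1)) (∸-monoʳ-≤ n k≤l)
  covB' : IsCover E C (take (n ∸ k' ∸ d) U)
  covB' = subst (λ m → IsCover E C (take m U))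
                (trans (cong (_∸ k') (length-drop d T)) (m∸n∸o≡m∸o∸n n d k')) covB
  l'≤|U| : l' ≤ length U
  l'≤|U| = ≤-trans (<⇒≤ l'<c) (≤-trans (cover-length E covB) (length-take≤ (length U ∸ k') U))
  border' : pre l' C ≈ suf (n ∸ l' + 1) T
  border' = subst (pre l' C ≈_) (suf-drop d T l'≤|U|) border
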